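{- Let $G=(V,E)$ be a finite graph (undirected, or directed) with $n=|V|$, and let $v\in V$. For every integer $d\ge 0$, \[ \sum_{w\in R(v)} d(v,w)\;\ge\; \sum_{w\in N_d(v)} d(v,w)\;-\;\tilde\gamma_{d+1}(v)\;+\;(d+2)\bigl(r(v)-n_d(v)\bigr), \] where $\tilde\gamma_{d+1}(v)=\sum_{u\in\Gamma_d(v)}\deg(u)$ if $G$ is undirected and $\tilde\gamma_{d+1}(v)=\sum_{u\in\Gamma_d(v)}\deg^{+}(u)$ (out-degree) if $G$ is directed.
   Context: $d(v,w)$ is the number of edges (arcs) in a shortest path from $v$ to $w$. $R(v)$ is the set of vertices reachable from $v$ (with $v\in R(v)$), and $r(v)=|R(v)|$. $\Gamma_d(v)=\{w\in V: d(v,w)=d\}$ is the set of vertices at distance exactly $d$ from $v$. $N_d(v)=\{w\in V: d(v,w)\le d\}$ is the ball of radius $d$ around $v$, and $n_d(v)=|N_d(v)|$. The left-hand side is the farness $f(v)$ of $v$; the right-hand side is denoted $\tilde f_d(v,r(v))$. -}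

module Defs where

open import Data.Nat using (ℕ; zero; suc; _+_; _*_; _≤_; _≤ᵇ_; _≡ᵇ_)
open import Data.Fin using (Fin; zero; suc)
open import Data.Bool using (Bool; true; false; T; if_then_else_; _∧_)
open import Data.Product using (Σ; _×_; ∃)
open import Relation.Binary.PropositionalEquality using (_≡_)
open import Function.Bundles using (_⇔_)

-- A finite (di)graph on vertex set V = Fin n, given by a Boolean
-- adjacency relation: there is an arc u → w iff T (adj u w).
Adj : ℕ → Set
Adj n = Fin n → Fin n → Bool

∑ : ∀ {n} → (Fin n → ℕ) → ℕ
∑ {zero}  f = 0
∑ {suc n} f = f zero + ∑ (λ i → f (suc i))

∑[_∈_] : ∀ {n} → (Fin n → ℕ) → (Fin n → Bool) → ℕ
∑[ f ∈ P ] = ∑ (λ w → if P w then f w else 0)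

∣_∣ : ∀ {n} → (Fin n → Bool) → ℕ
∣ P ∣ = ∑[ (λ _ → 1) ∈ P ]

outdeg : ∀ {n} → Adj n → Fin n → ℕ
outdeg adj u = ∣ adj u ∣

data Walk {n} (adj : Adj n) : Fin n → Fin n → ℕ → Set where
  here : ∀ {u} → Walk adj u u 0
  step : ∀ {u x w k} → T (adj u x) → Walk adj x w k → Walk adj u w (suc k)

Reachable : ∀ {n} → Adj n → Fin n → Fin n → Set
Reachable adj v w = ∃ λ k → Walk adj v w k

IsDist : ∀ {n} → Adj n → Fin n → Fin n → ℕ → Set
IsDist adj v w k = Walk adj v w k × (∀ j → Walk adj v w j → k ≤ j)

record UGraph (n : ℕ) : Set where
  field
    adj     : Adj n
    sym     : ∀ u w → adj u w ≡ adj w u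
    loopless : ∀ u → adj u u ≡ false

deg : ∀ {n} → UGraph n → Fin n → ℕ
deg G u = ∣ UGraph.adj G u ∣

-- The quantities of the lemma, given the reachability indicator
-- R (= R(v)) and the distance function δ (= d(v,·)) of a vertex v.
module Quantities {n} (R : Fin n → Bool) (δ : Fin n → ℕ) (d : ℕ) where
  farness : ℕ
  farness = ∑[ δ ∈ R ]
  r : ℕ
  r = ∣ R ∣
  N : Fin n → Bool
  N w = R w ∧ (δ w ≤ᵇ d)
  Γ : Fin n → Bool
  Γ w = R w ∧ (δ w ≡ᵇ d)
  n-d : ℕ
  n-d = ∣ N ∣
  sumN : ℕ
  sumN = ∑[ δ ∈ N ]

-- Split the vertices of R(v) into N_d(v), the sphere Γ_{d+1}(v) and the rest.
-- Vertices of N_d(v) contribute d(v,w) to both sides, those in Γ_{d+1}(v)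
-- have d(v,w) = d + 1 = (d + 2) − 1, and the remaining ones have
-- d(v,w) ≥ d + 2; so f(v) is bounded below by the right-hand side with
-- |Γ_{d+1}(v)| in place of γ̃_{d+1}(v). Finally, the last arc of a shortest
-- walk to a vertex of Γ_{d+1}(v) leaves a vertex of Γ_d(v), so counting these
-- arcs gives |Γ_{d+1}(v)| ≤ Σ_{u ∈ Γ_d(v)} deg⁺(u).
module Submission where

open import Defs
open import Data.Bool using (Bool; true; false; T; if_then_else_; _∧_)
open import Data.Bool.Properties using (T-∧)
open import Data.Fin using (Fin; zero; suc)
open import Data.Nat using (ℕ; zero; suc; _+_; _*_; _≤_; _≤ᵇ_; _≡ᵇ_; z≤n; s≤s⁻¹)
open import Data.Nat.Properties
open import Algebra.Properties.Semiring.Sum +-*-semiring as Sum using (sum)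
open import Data.Product using (_×_; _,_; proj₁; ∃)
open import Function.Bundles using (_⇔_; Equivalence)
open import Relation.Binary.PropositionalEquality
open import Relation.Nullary.Reflects using (Reflects; ofʸ; ofⁿ; fromEquivalence)

∑≗sum : ∀ {n} (f : Fin n → ℕ) → ∑ f ≡ sum f
∑≗sum {zero}  f = refl
∑≗sum {suc n} f = cong (f zero +_) (∑≗sum (λ i → f (suc i)))

∑-cong : ∀ {n} {f g : Fin n → ℕ} → (∀ i → f i ≡ g i) → ∑ f ≡ ∑ g
∑-cong {zero}  f≗g = refl
∑-cong {suc n} f≗g = cong₂ _+_ (f≗g zero) (∑-cong (λ i → f≗g (suc i)))

∑-mono-≤ : ∀ {n} {f g : Fin n → ℕ} → (∀ i → f i ≤ g i) → ∑ f ≤ ∑ g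
∑-mono-≤ {zero}  f≤g = z≤n
∑-mono-≤ {suc n} f≤g = +-mono-≤ (f≤g zero) (∑-mono-≤ (λ i → f≤g (suc i)))

∑-zero : ∀ {n} → ∑ {n} (λ _ → 0) ≡ 0
∑-zero {zero}  = refl
∑-zero {suc n} = ∑-zero {n}

f≤∑f : ∀ {n} (f : Fin n → ℕ) i → f i ≤ ∑ f
f≤∑f f zero    = m≤m+n _ _
f≤∑f f (suc i) = ≤-trans (f≤∑f (λ j → f (suc j)) i) (m≤n+m _ _)

∑-distrib-+ : ∀ {n} (f g : Fin n → ℕ) → ∑ (λ i → f i + g i) ≡ ∑ f + ∑ g
∑-distrib-+ f g = begin
  ∑ (λ i → f i + g i)       ≡⟨ ∑≗sum (λ i → f i + g i) ⟩
  sum (λ i → f i + g i)     ≡⟨ Sum.∑-distrib-+ f g ⟩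
  sum f + sum g             ≡⟨ sym (cong₂ _+_ (∑≗sum f) (∑≗sum g)) ⟩
  ∑ f + ∑ g                 ∎
  where open ≡-Reasoning

∑-comm : ∀ {m n} (f : Fin m → Fin n → ℕ) →
         ∑ (λ i → ∑ (λ j → f i j)) ≡ ∑ (λ j → ∑ (λ i → f i j))
∑-comm f = begin
  ∑ (λ i → ∑ (λ j → f i j))       ≡⟨ ∑≗sum (λ i → ∑ (λ j → f i j)) ⟩
  sum (λ i → ∑ (λ j → f i j))     ≡⟨ Sum.sum-cong-≗ (λ i → ∑≗sum (f i)) ⟩
  sum (λ i → sum (λ j → f i j))   ≡⟨ Sum.∑-comm f ⟩
  sum (λ j → sum (λ i → f i j))   ≡⟨ sym (Sum.sum-cong-≗ (λ j → ∑≗sum (λ i → f i j))) ⟩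
  sum (λ j → ∑ (λ i → f i j))     ≡⟨ sym (∑≗sum (λ j → ∑ (λ i → f i j))) ⟩
  ∑ (λ j → ∑ (λ i → f i j))       ∎
  where open ≡-Reasoning

*-distribˡ-∑ : ∀ {n} c (f : Fin n → ℕ) → c * ∑ f ≡ ∑ (λ i → c * f i)
*-distribˡ-∑ c f = begin
  c * ∑ f                 ≡⟨ cong (c *_) (∑≗sum f) ⟩
  c * sum f               ≡⟨ Sum.*-distribˡ-sum c f ⟩
  sum (λ i → c * f i)     ≡⟨ sym (∑≗sum (λ i → c * f i)) ⟩
  ∑ (λ i → c * f i)       ∎
  where open ≡-Reasoning

if-∑ : ∀ {n} (b : Bool) (f : Fin n → ℕ) →
       (if b then ∑ f else 0) ≡ ∑ (λ i → if b then f i else 0)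
if-∑ true      f = refl
if-∑ {n} false f = sym (∑-zero {n})

*-∣∣ : ∀ {n} c (P : Fin n → Bool) → c * ∣ P ∣ ≡ ∑[ (λ _ → c) ∈ P ]
*-∣∣ {n} c P = trans (*-distribˡ-∑ {n} c _) (∑-cong (λ w → *-indicator (P w)))
  where
  *-indicator : ∀ b → c * (if b then 1 else 0) ≡ (if b then c else 0)
  *-indicator true  = *-identityʳ c
  *-indicator false = *-zeroʳ c

module _ {n} {adj : Adj n} where

  _∷ʳ_ : ∀ {u x w k} → Walk adj u x k → T (adj x w) → Walk adj u w (suc k)
  here       ∷ʳ e = step e here
  step e′ p ∷ʳ e = step e′ (p ∷ʳ e)

  unsnoc : ∀ {u w k} → Walk adj u w (suc k) → ∃ λ x → Walk adj u x k × T (adj x w)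
  unsnoc (step e here)          = _ , here , e
  unsnoc (step e (step e′ p)) with unsnoc (step e′ p)
  ... | x , q , e″ = x , step e q , e″

  IsDist-unique : ∀ {v w j k} → IsDist adj v w j → IsDist adj v w k → j ≡ k
  IsDist-unique (p , min-p) (q , min-q) = ≤-antisym (min-p _ q) (min-q _ p)

  IsDist-predecessor : ∀ {v w k} → IsDist adj v w (suc k) →
                       ∃ λ u → IsDist adj v u k × T (adj u w)
  IsDist-predecessor (p , minimal) with unsnoc p
  ... | u , q , e = u , (q , λ j r → s≤s⁻¹ (minimal (suc j) (r ∷ʳ e))) , e

  ∣Q∣≤∑[outdeg∈P] : (P Q : Fin n → Bool) →
                    (∀ w → T (Q w) → ∃ λ u → T (P u) × T (adj u w)) →
                    ∣ Q ∣ ≤ ∑[ outdeg adj ∈ P ]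
  ∣Q∣≤∑[outdeg∈P] P Q covered = begin
    ∑ (λ w → indicator (Q w))          ≤⟨ ∑-mono-≤ covered-once ⟩
    ∑ (λ w → ∑ (λ u → arc u w))        ≡⟨ ∑-comm arc ⟨
    ∑ (λ u → ∑ (λ w → arc u w))        ≡⟨ ∑-cong (λ u → if-∑ (P u) (λ w → indicator (adj u w))) ⟨
    ∑[ outdeg adj ∈ P ]                ∎
    where
    open ≤-Reasoning
    indicator : Bool → ℕ
    indicator b = if b then 1 else 0
    arc : Fin n → Fin n → ℕ
    arc u w = if P u then indicator (adj u w) else 0
    covered-once : ∀ w → indicator (Q w) ≤ ∑ (λ u → arc u w)
    covered-once w with Q w in Qw
    ... | false = z≤n
    ... | true with covered w (subst T (sym Qw) _)
    ...   | u , Pu , e with P u | adj u w | f≤∑f (λ u → arc u w) u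
    ...     | true | true | 1≤∑ = 1≤∑

≡ᵇ-reflects-≡ : ∀ m n → Reflects (m ≡ n) (m ≡ᵇ n)
≡ᵇ-reflects-≡ m n = fromEquivalence (≡ᵇ⇒≡ m n) (≡⇒≡ᵇ m n)

farness-summand : ∀ (b : Bool) k d →
  (if b ∧ (k ≤ᵇ d) then k else 0) + (if b then d + 2 else 0) ≤
  (if b then k else 0) + (if b ∧ (k ≡ᵇ suc d) then 1 else 0) + (if b ∧ (k ≤ᵇ d) then d + 2 else 0)
farness-summand false k d = z≤n
farness-summand true  k d with k ≤ᵇ d | ≤ᵇ-reflects-≤ k d
... | true  | _       = +-monoˡ-≤ (d + 2) (m≤m+n k _)
... | false | ofⁿ k≰d with k ≡ᵇ suc d | ≡ᵇ-reflects-≡ k (suc d)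
...   | true  | ofʸ refl = ≤-reflexive (trans (+-suc d 1) (sym (+-identityʳ _)))
...   | false | ofⁿ k≢1+d = begin
  d + 2          ≡⟨ +-comm d 2 ⟩
  suc (suc d)    ≤⟨ ≤∧≢⇒< (≰⇒> k≰d) (λ 1+d≡k → k≢1+d (sym 1+d≡k)) ⟩
  k              ≡⟨ sym (trans (+-identityʳ _) (+-identityʳ k)) ⟩
  k + 0 + 0      ∎
  where open ≤-Reasoning

module _ {n} (adj : Adj n) (v : Fin n) (R : Fin n → Bool) (δ : Fin n → ℕ)
         (reach : ∀ w → T (R w) ⇔ Reachable adj v w)
         (dist : ∀ w → T (R w) → IsDist adj v w (δ w))
         (d : ℕ) where

  open Quantities R δ d

  Γ-next : Fin n → Bool
  Γ-next w = R w ∧ (δ w ≡ᵇ suc d)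

  Γ-next-predecessor : ∀ w → T (Γ-next w) → ∃ λ u → T (Γ u) × T (adj u w)
  Γ-next-predecessor w w∈Γ-next with Equivalence.to T-∧ w∈Γ-next
  ... | w∈R , δw≡1+d
    with IsDist-predecessor (subst (IsDist adj v w) (≡ᵇ⇒≡ (δ w) (suc d) δw≡1+d) (dist w w∈R))
  ...   | u , u-at-d , e = u , Equivalence.from T-∧ (u∈R , ≡⇒≡ᵇ (δ u) d δu≡d) , e
    where
    u∈R : T (R u)
    u∈R = Equivalence.from (reach u) (d , proj₁ u-at-d)
    δu≡d : δ u ≡ d
    δu≡d = IsDist-unique (dist u u∈R) u-at-d

  farness-≥-with-sphere :
    sumN + (d + 2) * r ≤ farness + ∣ Γ-next ∣ + (d + 2) * n-d
  farness-≥-with-sphere = begin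
    sumN + (d + 2) * r
      ≡⟨ cong (sumN +_) (*-∣∣ (d + 2) R) ⟩
    sumN + ∑[ (λ _ → d + 2) ∈ R ]
      ≡⟨ ∑-distrib-+ {n} _ _ ⟨
    ∑ (λ w → (if N w then δ w else 0) + (if R w then d + 2 else 0))
      ≤⟨ ∑-mono-≤ (λ w → farness-summand (R w) (δ w) d) ⟩
    ∑ (λ w → (if R w then δ w else 0) + (if Γ-next w then 1 else 0) + (if N w then d + 2 else 0))
      ≡⟨ ∑-distrib-+ {n} _ _ ⟩
    ∑ (λ w → (if R w then δ w else 0) + (if Γ-next w then 1 else 0)) + ∑[ (λ _ → d + 2) ∈ N ]
      ≡⟨ cong₂ _+_ (∑-distrib-+ {n} _ _) (sym (*-∣∣ (d + 2) N)) ⟩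
    farness + ∣ Γ-next ∣ + (d + 2) * n-d ∎
    where open ≤-Reasoning

  farness-lower-bound :
    sumN + (d + 2) * r ≤ farness + ∑[ outdeg adj ∈ Γ ] + (d + 2) * n-d
  farness-lower-bound =
    ≤-trans farness-≥-with-sphere
      (+-monoˡ-≤ ((d + 2) * n-d)
        (+-monoʳ-≤ farness (∣Q∣≤∑[outdeg∈P] Γ Γ-next Γ-next-predecessor)))

lemma1 :
    (∀ {n} (adj : Adj n) (v : Fin n) (R : Fin n → Bool) (δ : Fin n → ℕ)
       → (∀ w → T (R w) ⇔ Reachable adj v w)
       → (∀ w → T (R w) → IsDist adj v w (δ w))
       → ∀ (d : ℕ)
       → let open Quantities R δ d in
         sumN + (d + 2) * r ≤ farness + ∑[ outdeg adj ∈ Γ ] + (d + 2) * n-d)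
    ×
    (∀ {n} (G : UGraph n) (v : Fin n) (R : Fin n → Bool) (δ : Fin n → ℕ)
       → (∀ w → T (R w) ⇔ Reachable (UGraph.adj G) v w)
       → (∀ w → T (R w) → IsDist (UGraph.adj G) v w (δ w))
       → ∀ (d : ℕ)
       → let open Quantities R δ d in
         sumN + (d + 2) * r ≤ farness + ∑[ deg G ∈ Γ ] + (d + 2) * n-d)
lemma1 = farness-lower-bound , λ G → farness-lower-bound (UGraph.adj G)
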